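{- Let $S$ and $T$ be balanced bitstrings. If the unit of area $(x,y)$ is between $S$ and $T$, then $(2x+y+1,\,x+y)$ is between $w(S)$ and $w(T)$.
   Context: Two bitstrings are balanced if they have the same length and the same number of ones. $w$ is the map on bitstrings that simultaneously replaces each $0$ by $001$ and each $1$ by $01$ (e.g. $w(0010)=00100101001$). A unit of area is a pair $(x,y)\in\mathbb{Z}^2$. $(x,y)$ is below a string $S$ if some prefix of $S$ (possibly empty) has at most $x$ zeros and at least $y+1$ ones; $(x,y)$ is above $S$ if some prefix of $S$ has at most $y$ ones and at least $x+1$ zeros. For balanced $S,T$, $(x,y)$ is between $S$ and $T$ if it is above one of them and below the other. -}

module Defs where

open import Data.Bool using (Bool; true; false)
open import Data.List using (List; []; _∷_; _++_; length; take; concatMap)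
open import Data.Nat using (ℕ; zero; suc)
import Data.Nat as ℕ
open import Data.Integer using (ℤ; +_; _+_; _*_; _≤_)
open import Data.Product using (_×_; ∃-syntax)
open import Data.Sum using (_⊎_)
open import Relation.Binary.PropositionalEquality using (_≡_)

-- Bitstrings: false = 0, true = 1.
Bitstring : Set
Bitstring = List Bool

zeros : Bitstring → ℕ
zeros []           = zero
zeros (false ∷ s)  = suc (zeros s)
zeros (true ∷ s)   = zeros s

ones : Bitstring → ℕ
ones []           = zero
ones (false ∷ s)  = ones s
ones (true ∷ s)   = suc (ones s)

Balanced : Bitstring → Bitstring → Set
Balanced S T = (length S ≡ length T) × (ones S ≡ ones T)

wLetter : Bool → Bitstring
wLetter false = false ∷ false ∷ true ∷ []
wLetter true  = false ∷ true ∷ []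

w : Bitstring → Bitstring
w = concatMap wLetter

-- prefixes of S (possibly empty): take k S for k ≤ length S
-- (x,y) is below S: some prefix has at most x zeros and at least y+1 ones
Below : ℤ → ℤ → Bitstring → Set
Below x y S = ∃[ k ] (k ℕ.≤ length S) × (+ zeros (take k S) ≤ x) × (y + + 1 ≤ + ones (take k S))

Above : ℤ → ℤ → Bitstring → Set
Above x y S = ∃[ k ] (k ℕ.≤ length S) × (+ ones (take k S) ≤ y) × (x + + 1 ≤ + zeros (take k S))

Between : ℤ → ℤ → Bitstring → Bitstring → Set
Between x y S T = (Above x y S × Below x y T) ⊎ (Above x y T × Below x y S)

-- Cut S at its prefix of length m = x + y + 1. S passes above (x,y) exactly when that prefix has
-- more than x zeros, and below exactly when it has at most x; balance makes both strings long
-- enough to be cut there. Since w turns a prefix Q into a prefix with zeros Q + |Q| zeros and |Q|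
-- ones, the image of the cut of T gives a prefix of w T witnessing "below", and the image of the
-- cut of S, minus its final 1, gives a prefix of w S witnessing "above".
module Submission where

open import Defs
open import Data.Integer using (ℤ; +_; _+_; _*_; -[1+_]; +≤+)
import Data.Integer as ℤ
open import Data.Integer.Properties using (pos-*)
open import Data.Bool using (true; false)
open import Data.List using (List; []; _∷_; _++_; length; take; drop)
open import Data.List.Properties using (concatMap-++; take++drop≡id; length-++; length-take; ++-assoc)
open import Data.Nat using (suc; _≤_; _<_; s≤s; z≤n)
import Data.Nat as ℕ
open import Data.Nat.Properties
open import Data.Nat.Solver using (module +-*-Solver)
open import Data.Product using (_×_; _,_; ∃-syntax)
open import Data.Sum using (inj₁; inj₂)
open import Relation.Binary.PropositionalEquality

open +-*-Solver using (solve; _:+_; _:*_; con; _:=_)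

zeros+ones≡length : ∀ s → zeros s ℕ.+ ones s ≡ length s
zeros+ones≡length []          = refl
zeros+ones≡length (false ∷ s) = cong suc (zeros+ones≡length s)
zeros+ones≡length (true ∷ s)  = trans (+-suc (zeros s) (ones s)) (cong suc (zeros+ones≡length s))

zeros-++ : ∀ u v → zeros (u ++ v) ≡ zeros u ℕ.+ zeros v
zeros-++ []          v = refl
zeros-++ (false ∷ u) v = cong suc (zeros-++ u v)
zeros-++ (true ∷ u)  v = zeros-++ u v

ones-++ : ∀ u v → ones (u ++ v) ≡ ones u ℕ.+ ones v
ones-++ []          v = refl
ones-++ (false ∷ u) v = ones-++ u v
ones-++ (true ∷ u)  v = cong suc (ones-++ u v)

zeros-take-mono : ∀ {i j} s → i ≤ j → zeros (take i s) ≤ zeros (take j s)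
zeros-take-mono s           z≤n       = z≤n
zeros-take-mono []          (s≤s i≤j) = z≤n
zeros-take-mono (false ∷ s) (s≤s i≤j) = s≤s (zeros-take-mono s i≤j)
zeros-take-mono (true ∷ s)  (s≤s i≤j) = zeros-take-mono s i≤j

ones-take-mono : ∀ {i j} s → i ≤ j → ones (take i s) ≤ ones (take j s)
ones-take-mono s           z≤n       = z≤n
ones-take-mono []          (s≤s i≤j) = z≤n
ones-take-mono (false ∷ s) (s≤s i≤j) = ones-take-mono s i≤j
ones-take-mono (true ∷ s)  (s≤s i≤j) = s≤s (ones-take-mono s i≤j)

zeros-take-≤ : ∀ k s → zeros (take k s) ≤ zeros s
zeros-take-≤ k s = subst (λ t → zeros (take k s) ≤ zeros t) (take++drop≡id k s)
  (subst (zeros (take k s) ≤_) (sym (zeros-++ (take k s) (drop k s))) (m≤m+n _ _))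

ones-take-≤ : ∀ k s → ones (take k s) ≤ ones s
ones-take-≤ k s = subst (λ t → ones (take k s) ≤ ones t) (take++drop≡id k s)
  (subst (ones (take k s) ≤_) (sym (ones-++ (take k s) (drop k s))) (m≤m+n _ _))

length-take-≤ : ∀ {A : Set} {m} (xs : List A) → m ≤ length xs → length (take m xs) ≡ m
length-take-≤ {m = m} s m≤len = trans (length-take m s) (m≤n⇒m⊓n≡m m≤len)

zeros+ones-take : ∀ {m} s → m ≤ length s → zeros (take m s) ℕ.+ ones (take m s) ≡ m
zeros+ones-take {m} s m≤len = trans (zeros+ones≡length (take m s)) (length-take-≤ s m≤len)

take-length-++ : ∀ {A : Set} (u v : List A) → take (length u) (u ++ v) ≡ u
take-length-++ []      v = refl
take-length-++ (a ∷ u) v = cong (a ∷_) (take-length-++ u v)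

length-≤-++ : ∀ {A : Set} (u v : List A) → length u ≤ length (u ++ v)
length-≤-++ u v = subst (length u ≤_) (sym (length-++ u)) (m≤m+n _ _)

above-of-prefix : ∀ {x y s} u v → u ++ v ≡ s →
  + ones u ℤ.≤ y → x + + 1 ℤ.≤ + zeros u → Above x y s
above-of-prefix u v refl o z =
  length u , length-≤-++ u v
  , subst (λ t → + ones t ℤ.≤ _) (sym (take-length-++ u v)) o
  , subst (λ t → _ ℤ.≤ + zeros t) (sym (take-length-++ u v)) z

below-of-prefix : ∀ {x y s} u v → u ++ v ≡ s →
  + zeros u ℤ.≤ x → y + + 1 ℤ.≤ + ones u → Below x y s
below-of-prefix u v refl z o =
  length u , length-≤-++ u v
  , subst (λ t → + zeros t ℤ.≤ _) (sym (take-length-++ u v)) z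
  , subst (λ t → _ ℤ.≤ + ones t) (sym (take-length-++ u v)) o

+1≤⇒< : ∀ {m n} → m ℕ.+ 1 ≤ n → m < n
+1≤⇒< {m} {n} = subst (_≤ n) (+-comm m 1)

zeros>-of-ones≤ : ∀ {a b x y} → a ℕ.+ b ≡ suc (x ℕ.+ y) → b ≤ y → x < a
zeros>-of-ones≤ {a} {b} {x} {y} a+b≡ b≤y = +-cancelʳ-≤ y (suc x) a (begin
  suc x ℕ.+ y ≡⟨ sym a+b≡ ⟩
  a ℕ.+ b     ≤⟨ +-monoʳ-≤ a b≤y ⟩
  a ℕ.+ y     ∎)
  where open ≤-Reasoning

zeros≤-of-ones> : ∀ {a b x y} → a ℕ.+ b ≡ suc (x ℕ.+ y) → y < b → a ≤ x
zeros≤-of-ones> {a} {b} {x} {y} a+b≡ y<b = +-cancelʳ-≤ (suc y) a x (begin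
  a ℕ.+ suc y ≤⟨ +-monoʳ-≤ a y<b ⟩
  a ℕ.+ b     ≡⟨ a+b≡ ⟩
  suc x ℕ.+ y ≡⟨ sym (+-suc x y) ⟩
  x ℕ.+ suc y ∎)
  where open ≤-Reasoning

above⇒zeros-take> : ∀ {x y} s → Above (+ x) (+ y) s → suc (x ℕ.+ y) ≤ length s →
  x < zeros (take (suc (x ℕ.+ y)) s)
above⇒zeros-take> s (k , _ , +≤+ ones≤ , +≤+ zeros>) m≤len with ≤-total k (suc _)
... | inj₁ k≤m = ≤-trans (+1≤⇒< zeros>) (zeros-take-mono s k≤m)
... | inj₂ m≤k = zeros>-of-ones≤ (zeros+ones-take s m≤len) (≤-trans (ones-take-mono s m≤k) ones≤)

below⇒zeros-take≤ : ∀ {x y} s → Below (+ x) (+ y) s → suc (x ℕ.+ y) ≤ length s →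
  zeros (take (suc (x ℕ.+ y)) s) ≤ x
below⇒zeros-take≤ s (k , _ , +≤+ zeros≤ , +≤+ ones>) m≤len with ≤-total k (suc _)
... | inj₁ k≤m = zeros≤-of-ones> (zeros+ones-take s m≤len) (≤-trans (+1≤⇒< ones>) (ones-take-mono s k≤m))
... | inj₂ m≤k = ≤-trans (zeros-take-mono s m≤k) zeros≤

balanced⇒long : ∀ {x y S T} → Balanced S T → Above (+ x) (+ y) S → Below (+ x) (+ y) T →
  suc (x ℕ.+ y) ≤ length S
balanced⇒long {S = S} {T} (_ , ones≡) (k , _ , _ , +≤+ zeros>) (j , _ , _ , +≤+ ones>) = begin
  suc _               ≤⟨ +-mono-≤ (≤-trans (+1≤⇒< zeros>) (zeros-take-≤ k S))
                                  (≤-trans (m≤m+n _ 1) (≤-trans ones> (ones-take-≤ j T))) ⟩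
  zeros S ℕ.+ ones T  ≡⟨ cong (zeros S ℕ.+_) (sym ones≡) ⟩
  zeros S ℕ.+ ones S  ≡⟨ zeros+ones≡length S ⟩
  length S            ∎
  where open ≤-Reasoning

w-++ : ∀ u v → w (u ++ v) ≡ w u ++ w v
w-++ = concatMap-++ wLetter

zeros-w : ∀ s → zeros (w s) ≡ zeros s ℕ.+ length s
zeros-w []          = refl
zeros-w (false ∷ s) = cong suc (trans (cong suc (zeros-w s)) (sym (+-suc (zeros s) (length s))))
zeros-w (true ∷ s)  = trans (cong suc (zeros-w s)) (sym (+-suc (zeros s) (length s)))

ones-w : ∀ s → ones (w s) ≡ length s
ones-w []          = refl
ones-w (false ∷ s) = cong suc (ones-w s)
ones-w (true ∷ s)  = cong suc (ones-w s)

w-ends-with-one : ∀ b s → ∃[ u ] w (b ∷ s) ≡ u ++ true ∷ []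
w-ends-with-one false []      = false ∷ false ∷ [] , refl
w-ends-with-one true  []      = false ∷ [] , refl
w-ends-with-one b     (c ∷ s) with w-ends-with-one c s
... | u , eq = wLetter b ++ u , trans (cong (wLetter b ++_) eq) (sym (++-assoc (wLetter b) u _))

zeros-w-take : ∀ {m} s → m ≤ length s → zeros (w (take m s)) ≡ zeros (take m s) ℕ.+ m
zeros-w-take {m} s m≤len = trans (zeros-w (take m s)) (cong (zeros (take m s) ℕ.+_) (length-take-≤ s m≤len))

ones-w-take : ∀ {m} s → m ≤ length s → ones (w (take m s)) ≡ m
ones-w-take {m} s m≤len = trans (ones-w (take m s)) (length-take-≤ s m≤len)

w-take++w-drop : ∀ m s → w (take m s) ++ w (drop m s) ≡ w s
w-take++w-drop m s = trans (sym (w-++ (take m s) (drop m s))) (cong w (take++drop≡id m s))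

w-below : ∀ {x y} s → suc (x ℕ.+ y) ≤ length s → zeros (take (suc (x ℕ.+ y)) s) ≤ x →
  Below (+ (2 ℕ.* x ℕ.+ y ℕ.+ 1)) (+ (x ℕ.+ y)) (w s)
w-below {x} {y} s m≤len cut≤ =
  below-of-prefix {y = + (x ℕ.+ y)} (w (take m s)) _ (w-take++w-drop m s) (+≤+ zeros≤) (+≤+ ones≥)
  where
  m = suc (x ℕ.+ y)
  open ≤-Reasoning
  zeros≤ : zeros (w (take m s)) ≤ 2 ℕ.* x ℕ.+ y ℕ.+ 1
  zeros≤ = begin
    zeros (w (take m s))      ≡⟨ zeros-w-take s m≤len ⟩
    zeros (take m s) ℕ.+ m    ≤⟨ +-monoˡ-≤ m cut≤ ⟩
    x ℕ.+ suc (x ℕ.+ y)       ≡⟨ solve 2 (λ x y → x :+ (con 1 :+ (x :+ y)) := con 2 :* x :+ y :+ con 1) refl x y ⟩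
    2 ℕ.* x ℕ.+ y ℕ.+ 1       ∎
  ones≥ : x ℕ.+ y ℕ.+ 1 ≤ ones (w (take m s))
  ones≥ = ≤-reflexive (trans (+-comm (x ℕ.+ y) 1) (sym (ones-w-take {m} s m≤len)))

w-above : ∀ {x y} s → suc (x ℕ.+ y) ≤ length s → x < zeros (take (suc (x ℕ.+ y)) s) →
  Above (+ (2 ℕ.* x ℕ.+ y ℕ.+ 1)) (+ (x ℕ.+ y)) (w s)
w-above []      ()    _
w-above {x} {y} (b ∷ s) m≤len cut> with w-ends-with-one b (take (x ℕ.+ y) s)
... | u , wQ≡u1 =
  above-of-prefix {x = + (2 ℕ.* x ℕ.+ y ℕ.+ 1)} u _ prefix (+≤+ (≤-pred (+1≤⇒< (≤-reflexive ones≡)))) (+≤+ zeros≥)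
  where
  m = suc (x ℕ.+ y)
  Q = take m (b ∷ s)
  W = w (drop m (b ∷ s))
  one = true ∷ []
  prefix : u ++ true ∷ W ≡ w (b ∷ s)
  prefix = begin
    u ++ one ++ W    ≡⟨ sym (++-assoc u one W) ⟩
    (u ++ one) ++ W  ≡⟨ cong (_++ W) (sym wQ≡u1) ⟩
    w Q ++ W         ≡⟨ w-take++w-drop m (b ∷ s) ⟩
    w (b ∷ s)        ∎
    where open ≡-Reasoning
  ones≡ : ones u ℕ.+ 1 ≡ m
  ones≡ = begin
    ones u ℕ.+ 1     ≡⟨ sym (ones-++ u one) ⟩
    ones (u ++ one)  ≡⟨ cong ones (sym wQ≡u1) ⟩
    ones (w Q)       ≡⟨ ones-w-take (b ∷ s) m≤len ⟩
    m                ∎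
    where open ≡-Reasoning
  zeros≥ : 2 ℕ.* x ℕ.+ y ℕ.+ 1 ℕ.+ 1 ≤ zeros u
  zeros≥ = begin
    2 ℕ.* x ℕ.+ y ℕ.+ 1 ℕ.+ 1 ≡⟨ solve 2 (λ x y → con 2 :* x :+ y :+ con 1 :+ con 1
                                               := (con 1 :+ x) :+ (con 1 :+ (x :+ y))) refl x y ⟩
    suc x ℕ.+ m               ≤⟨ +-monoˡ-≤ m cut> ⟩
    zeros Q ℕ.+ m             ≡⟨ sym (zeros-w-take (b ∷ s) m≤len) ⟩
    zeros (w Q)               ≡⟨ cong zeros wQ≡u1 ⟩
    zeros (u ++ one)          ≡⟨ zeros-++ u one ⟩
    zeros u ℕ.+ 0             ≡⟨ +-identityʳ _ ⟩
    zeros u                   ∎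
    where open ≤-Reasoning

w-above-below : ∀ {S T x y} → Balanced S T → Above x y S → Below x y T →
  Above (+ 2 * x + y + + 1) (x + y) (w S) × Below (+ 2 * x + y + + 1) (x + y) (w T)
w-above-below {y = -[1+ _ ]} _ (_ , _ , () , _) _
w-above-below {x = -[1+ _ ]} _ _ (_ , _ , () , _)
w-above-below {S} {T} {+ x} {+ y} bal@(length≡ , _) above below =
  subst (λ c → Above (c + + y + + 1) (+ (x ℕ.+ y)) (w S) × Below (c + + y + + 1) (+ (x ℕ.+ y)) (w T))
        (pos-* 2 x)
        ( w-above S m≤S (above⇒zeros-take> S above m≤S)
        , w-below T m≤T (below⇒zeros-take≤ T below m≤T))
  where
  m≤S : suc (x ℕ.+ y) ≤ length S
  m≤S = balanced⇒long bal above below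
  m≤T : suc (x ℕ.+ y) ≤ length T
  m≤T = subst (suc (x ℕ.+ y) ≤_) length≡ m≤S

lemma5 : (S T : Bitstring) (x y : ℤ) →
    Balanced S T →
    Between x y S T →
    Between (+ 2 * x + y + + 1) (x + y) (w S) (w T)
lemma5 S T x y bal (inj₁ (above , below)) = inj₁ (w-above-below bal above below)
lemma5 S T x y (length≡ , ones≡) (inj₂ (above , below)) =
  inj₂ (w-above-below (sym length≡ , sym ones≡) above below)
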